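{- A finite simple graph $G$ is a Cameron graph if and only if there exists a coloring $c: V(G) \to \{\text{black}, \text{white}\}$ such that for every subset $U \subseteq V(G)$ with $|U| \ge 2$ there is a partition $U = A \cup B$ into two nonempty disjoint sets such that either (i) for all $a \in A$, $b \in B$: $a$ and $b$ are adjacent in $G$ if and only if $c(a) = c(b)$; or (ii) for all $a \in A$, $b \in B$: $a$ and $b$ are adjacent in $G$ if and only if $c(a) \neq c(b)$.
   Context: A cograph is a finite simple graph with no induced subgraph isomorphic to $P_4$ (the path on four vertices). For a graph $G$ and a subset $S \subseteq V(G)$, the Seidel switch of $G$ with respect to $S$ is the graph on $V(G)$ obtained from $G$ by complementing the adjacency of every pair $\{x,y\}$ with $x \in S$ and $y \in V(G)\setminus S$, all other adjacencies being unchanged. A graph is a Cameron graph if it can be obtained from a cograph by a Seidel switch with respect to some subset of its vertices. -}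

module Defs where

open import Data.Nat using (ℕ; suc)
open import Data.Bool using (Bool; true; false; not; _xor_; if_then_else_)
open import Data.Fin using (Fin)
open import Data.Fin.Subset using (Subset; _∈_; _∪_; _∩_; ⊥; Nonempty)
open import Data.Fin.Subset.Properties using (_∈?_)
open import Data.Product using (Σ; ∃; _×_; _,_)
open import Function.Definitions using (Injective)
open import Relation.Binary.PropositionalEquality using (_≡_; _≢_; refl)
open import Relation.Nullary using (¬_; does)
open import Function.Bundles using (_⇔_)

record Graph (n : ℕ) : Set where
  field
    adj    : Fin n → Fin n → Bool
    sym    : ∀ x y → adj x y ≡ adj y x
    irrefl : ∀ x → adj x x ≡ false
open Graph public

Adj : ∀ {n} → Graph n → Fin n → Fin n → Set
Adj G x y = adj G x y ≡ true

p4adj : Fin 4 → Fin 4 → Bool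
p4adj Fin.zero (Fin.suc Fin.zero) = true
p4adj (Fin.suc Fin.zero) Fin.zero = true
p4adj (Fin.suc Fin.zero) (Fin.suc (Fin.suc Fin.zero)) = true
p4adj (Fin.suc (Fin.suc Fin.zero)) (Fin.suc Fin.zero) = true
p4adj (Fin.suc (Fin.suc Fin.zero)) (Fin.suc (Fin.suc (Fin.suc Fin.zero))) = true
p4adj (Fin.suc (Fin.suc (Fin.suc Fin.zero))) (Fin.suc (Fin.suc Fin.zero)) = true
p4adj _ _ = false

HasInducedP4 : ∀ {n} → Graph n → Set
HasInducedP4 {n} G = Σ (Fin 4 → Fin n) λ f →
  Injective _≡_ _≡_ f × (∀ i j → adj G (f i) (f j) ≡ p4adj i j)

Cograph : ∀ {n} → Graph n → Set
Cograph G = ¬ HasInducedP4 G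

mem : ∀ {n} → Fin n → Subset n → Bool
mem x S = does (x ∈? S)

switchAdj : ∀ {n} → Graph n → Subset n → Fin n → Fin n → Bool
switchAdj G S x y = if mem x S xor mem y S then not (adj G x y) else adj G x y

private
  xor-comm : ∀ a b → a xor b ≡ b xor a
  xor-comm false false = refl
  xor-comm false true  = refl
  xor-comm true  false = refl
  xor-comm true  true  = refl

  xor-self : ∀ a → a xor a ≡ false
  xor-self false = refl
  xor-self true  = refl

switchAdj-sym : ∀ {n} (G : Graph n) (S : Subset n) x y →
  switchAdj G S x y ≡ switchAdj G S y x
switchAdj-sym G S x y rewrite xor-comm (mem x S) (mem y S) | Graph.sym G x y = refl

switchAdj-irrefl : ∀ {n} (G : Graph n) (S : Subset n) x → switchAdj G S x x ≡ false
switchAdj-irrefl G S x rewrite xor-self (mem x S) = Graph.irrefl G x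

seidelSwitch : ∀ {n} → Graph n → Subset n → Graph n
seidelSwitch G S = record
  { adj = switchAdj G S ; sym = switchAdj-sym G S ; irrefl = switchAdj-irrefl G S }

IsCameron : ∀ {n} → Graph n → Set
IsCameron {n} G = Σ (Graph n) λ H → Σ (Subset n) λ S →
  Cograph H × (∀ x y → adj G x y ≡ adj (seidelSwitch H S) x y)

data Colour : Set where
  black white : Colour

IsPartition : ∀ {n} → Subset n → Subset n → Subset n → Set
IsPartition U A B = (A ∪ B ≡ U) × (A ∩ B ≡ ⊥) × Nonempty A × Nonempty B

module Submission where

-- The theorem is the classical characterisation of cographs (Seinsche) seen
-- through a Seidel switch.  Call a split U = A ∪ B of a vertex set
-- β-homogeneous in H when every pair a ∈ A, b ∈ B has adjacency β in H.
--
--   Cograph characterisation: H has no induced P4 iff every vertex set with at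
--   least two vertices has a homogeneous split.  Forward, by induction on U:
--   remove a vertex v, take a β-cut of U - v and extend it to U; each way the
--   extension can fail exhibits an induced P4.  Backward, the edges and the
--   non-edges of a P4 both connect its four vertices, so its vertex set has no
--   homogeneous split.
--
--   Switching: if S is the set of black vertices of a colouring c, switching
--   by S flips adjacency exactly on the bichromatic pairs, so a β-homogeneous
--   split of H is a split of G = switch H S obeying rule (i) (β = true) or
--   rule (ii) (β = false), and conversely.

open import Defs
open import Data.Nat using (ℕ; _≥_)
open import Data.Fin using (Fin)
open import Data.Fin.Subset using (Subset; _∈_; ∣_∣)
open import Data.Product using (Σ; _×_)
open import Data.Sum using (_⊎_)
open import Function.Bundles using (_⇔_)
open import Relation.Binary.PropositionalEquality using (_≡_; _≢_)

open import Data.Bool using (Bool; true; false; not; _xor_)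
open import Data.Bool.Properties using (¬-not; not-¬; xor-assoc; xor-same)
  renaming (_≟_ to _≟ᵇ_)
open import Data.Empty using (⊥-elim)
open import Data.Fin using (zero; suc)
open import Data.Fin.Properties using (any?; all?; 0≢1+n) renaming (_≟_ to _≟ᶠ_)
open import Data.Fin.Subset
  using (_∉_; _∪_; _∩_; _─_; _-_; ∁; ⁅_⁆; ⊥; ⊤; _⊂_; outside)
open import Data.Fin.Subset.Properties
  using ( _∈?_; nonempty?; x∈p∩q⁺; x∈p∩q⁻; x∈p∪q⁺; x∈p∪q⁻; ∩-distribˡ-∪; ∩-identityʳ
        ; ∪-comm; ∩-comm; p∪∁p≡⊤; x∈p⇒x∉∁p; x∈∁p⇒x∉p; x∉∁p⇒x∈p; x∉p⇒x∈∁p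
        ; ⊆-antisym; ⊥⊆; ∉⊥; ∣⊥∣≡0; ∣⁅x⁆∣≡1; x∈⁅x⁆; x∈⁅y⁆⇒x≡y; x≢y⇒x∉⁅y⁆; x∉⁅y⁆⇒x≢y
        ; p⊆q⇒∣p∣≤∣q∣; p─q⊆p; x∈p∧x≢y⇒x∈p-y; x∈p⇒p-x⊂p; x∈p⇒∣p-x∣<∣p∣ )
open import Data.Fin.Subset.Induction using (Acc; acc; ⊂-wellFounded)
open import Data.Nat using (_≤_; s≤s)
open import Data.Nat.Properties using (≤-trans)
open import Data.Product using (∃; ∃₂; _,_; proj₁; proj₂)
open import Data.Sum using (inj₁; inj₂)
open import Data.Vec using (_∷_; []; lookup; tabulate; here; there)
open import Data.Vec.Properties using (lookup∘tabulate; []=⇒lookup; lookup⇒[]=)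
open import Function.Bundles using (mk⇔; Equivalence)
open import Function.Base using (case_of_)
open import Function.Definitions using (Injective)
import Relation.Binary.PropositionalEquality as ≡
open ≡ using (refl; trans; cong; subst; ≢-sym; module ≡-Reasoning)
open import Relation.Nullary using (yes; no; ¬_; does; contradiction)
open import Relation.Nullary.Decidable
  using (dec-true; dec-false; does-⇔; decidable-stable; _×-dec_; _→-dec_; ¬?; toWitness)
open import Relation.Unary using (Decidable)

private
  variable
    n : ℕ

≢not⇒≡ : {b β : Bool} → b ≢ not β → b ≡ β
≢not⇒≡ {b} {β} b≢¬β = decidable-stable (b ≟ᵇ β) λ b≢β → b≢¬β (¬-not b≢β)

xor-cancel : ∀ d g → d xor (d xor g) ≡ g
xor-cancel d g = trans (≡.sym (xor-assoc d d g)) (cong (_xor g) (xor-same d))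

⟦_⟧ : {P : Fin n → Set} → Decidable P → Subset n
⟦ P? ⟧ = tabulate (λ x → does (P? x))

∈⟦⟧ : {P : Fin n → Set} (P? : Decidable P) {x : Fin n} → x ∈ ⟦ P? ⟧ ⇔ P x
∈⟦⟧ {P = P} P? {x} = mk⇔ to from
  where
  to : x ∈ ⟦ P? ⟧ → P x
  to x∈ = decidable-stable (P? x) λ ¬Px →
    contradiction (trans (≡.sym member) (dec-false (P? x) ¬Px)) λ ()
    where
    member : does (P? x) ≡ true
    member = trans (≡.sym (lookup∘tabulate _ x)) ([]=⇒lookup x∈)
  from : P x → x ∈ ⟦ P? ⟧
  from Px = lookup⇒[]= x _ (trans (lookup∘tabulate _ x) (dec-true (P? x) Px))

x∈p─q⇒x∉q : {p q : Subset n} {x : Fin n} → x ∈ p ─ q → x ∉ q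
x∈p─q⇒x∉q {p = _ ∷ _} {q = outside ∷ _} here ()
x∈p─q⇒x∉q {p = _ ∷ _} {q = _ ∷ _} (there x∈p─q) (there x∈q) = x∈p─q⇒x∉q x∈p─q x∈q

∈-remove⁻ : {p : Subset n} {x y : Fin n} → x ∈ p - y → x ∈ p × x ≢ y
∈-remove⁻ {p = p} {y = y} x∈p-y = p─q⊆p p ⁅ y ⁆ x∈p-y , x∉⁅y⁆⇒x≢y (x∈p─q⇒x∉q x∈p-y)

all-or-counterexample : {P : Fin n → Set} → Decidable P → (p : Subset n) →
  (∀ {x} → x ∈ p → P x) ⊎ (∃ λ x → x ∈ p × ¬ P x)
all-or-counterexample P? p with any? (λ x → x ∈? p ×-dec ¬? (P? x))
... | yes counterexample = inj₂ counterexample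
... | no none = inj₁ λ {x} x∈p → decidable-stable (P? x) λ ¬Px → none (x , x∈p , ¬Px)

two-elements⁻ : {U : Subset n} {x y : Fin n} → x ∈ U → y ∈ U → x ≢ y → ∣ U ∣ ≥ 2
two-elements⁻ {U = U} {x} {y} x∈U y∈U x≢y =
  ≤-trans (s≤s (subst (_≤ ∣ U - x ∣) (∣⁅x⁆∣≡1 y) (p⊆q⇒∣p∣≤∣q∣ singleton⊆)))
          (x∈p⇒∣p-x∣<∣p∣ x∈U)
  where
  singleton⊆ : ∀ {z} → z ∈ ⁅ y ⁆ → z ∈ U - x
  singleton⊆ z∈⁅y⁆ rewrite x∈⁅y⁆⇒x≡y y z∈⁅y⁆ = x∈p∧x≢y⇒x∈p-y y∈U (≢-sym x≢y)

two-elements⁺ : {n : ℕ} (U : Subset n) → ∣ U ∣ ≥ 2 → ∃₂ λ x y → x ∈ U × y ∈ U × x ≢ y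
two-elements⁺ {n} U 2≤∣U∣ with nonempty? U
... | no empty = contradiction (≤-trans 2≤∣U∣ (subst (∣ U ∣ ≤_) (∣⊥∣≡0 n) (p⊆q⇒∣p∣≤∣q∣ ⊆⊥))) λ ()
  where
  ⊆⊥ : ∀ {x} → x ∈ U → x ∈ ⊥
  ⊆⊥ x∈U = contradiction (_ , x∈U) empty
... | yes (x , x∈U) with all-or-counterexample (_≟ᶠ x) U
...   | inj₂ (y , y∈U , y≢x) = x , y , x∈U , y∈U , ≢-sym y≢x
...   | inj₁ only-x =
        contradiction (≤-trans 2≤∣U∣ (subst (∣ U ∣ ≤_) (∣⁅x⁆∣≡1 x) (p⊆q⇒∣p∣≤∣q∣ ⊆⁅x⁆)))
                      λ { (s≤s ()) }
  where
  ⊆⁅x⁆ : ∀ {y} → y ∈ U → y ∈ ⁅ x ⁆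
  ⊆⁅x⁆ y∈U rewrite only-x y∈U = x∈⁅x⁆ x

image : {k : ℕ} → (Fin k → Fin n) → Subset n
image f = ⟦ (λ x → any? (λ i → f i ≟ᶠ x)) ⟧

∈-image : {k : ℕ} (f : Fin k → Fin n) (i : Fin k) → f i ∈ image f
∈-image f i = Equivalence.from (∈⟦⟧ (λ x → any? (λ i → f i ≟ᶠ x))) (i , refl)

∈-image⁻ : {k : ℕ} (f : Fin k → Fin n) {x : Fin n} → x ∈ image f → ∃ λ i → f i ≡ x
∈-image⁻ f = Equivalence.to (∈⟦⟧ (λ x → any? (λ i → f i ≟ᶠ x)))

pattern p₀ = zero
pattern p₁ = suc zero
pattern p₂ = suc (suc zero)
pattern p₃ = suc (suc (suc zero))

-- P4 and its complement p₂ - p₀ - p₃ - p₁ are both connected: a property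
-- propagated along the (not β)-pairs of P4 reaches every vertex from p₀.
p4-spread : ∀ β (P : Fin 4 → Set) → (∀ i j → p4adj i j ≡ not β → P i → P j) →
  P p₀ → ∀ i → P i
p4-spread false P step P-p₀ p₀ = P-p₀
p4-spread false P step P-p₀ p₁ = step p₀ p₁ refl P-p₀
p4-spread false P step P-p₀ p₂ = step p₁ p₂ refl (step p₀ p₁ refl P-p₀)
p4-spread false P step P-p₀ p₃ = step p₂ p₃ refl (step p₁ p₂ refl (step p₀ p₁ refl P-p₀))
p4-spread true  P step P-p₀ p₀ = P-p₀
p4-spread true  P step P-p₀ p₁ = step p₃ p₁ refl (step p₀ p₃ refl P-p₀)
p4-spread true  P step P-p₀ p₂ = step p₀ p₂ refl P-p₀
p4-spread true  P step P-p₀ p₃ = step p₀ p₃ refl P-p₀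

p4-rows-distinct : ∀ i j → (∀ k → p4adj i k ≡ p4adj j k) → i ≡ j
p4-rows-distinct = toWitness {a? = all? λ i → all? λ j →
  all? (λ k → p4adj i k ≟ᵇ p4adj j k) →-dec (i ≟ᶠ j)} _

Homogeneous : Graph n → Bool → Subset n → Subset n → Set
Homogeneous H β A B = ∀ a b → a ∈ A → b ∈ B → adj H a b ≡ β

HomogeneousSplit : Graph n → Bool → Subset n → Set
HomogeneousSplit {n} H β U =
  Σ (Subset n) λ A → Σ (Subset n) λ B → IsPartition U A B × Homogeneous H β A B

EverySplits : Graph n → Set
EverySplits {n} H = ∀ (U : Subset n) → ∣ U ∣ ≥ 2 → Σ Bool λ β → HomogeneousSplit H β U

swap-partition : {U A B : Subset n} → IsPartition U A B → IsPartition U B A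
swap-partition {A = A} {B} (A∪B≡U , A∩B≡⊥ , neA , neB) =
  trans (∪-comm B A) A∪B≡U , trans (∩-comm B A) A∩B≡⊥ , neB , neA

swap-homogeneous : (H : Graph n) {β : Bool} {A B : Subset n} →
  Homogeneous H β A B → Homogeneous H β B A
swap-homogeneous H hom a b a∈B b∈A = trans (sym H a b) (hom b a b∈A a∈B)

-- Cuts of a vertex set, and why a cograph always has one

module Cuts {n : ℕ} (H : Graph n) where

  record Cut (β : Bool) (U X : Subset n) : Set where
    field
      inner : ∃ λ x → x ∈ U × x ∈ X
      outer : ∃ λ y → y ∈ U × y ∉ X
      cross : ∀ {a b} → a ∈ U → a ∈ X → b ∈ U → b ∉ X → adj H a b ≡ β

  Cuttable : Subset n → Set
  Cuttable U = Σ Bool λ β → Σ (Subset n) λ X → Cut β U X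

  swapped : ∀ {x y b} → adj H x y ≡ b → adj H y x ≡ b
  swapped {x} {y} = trans (sym H y x)

  level : Fin n → Bool → Subset n
  level v β = ⟦ (λ m → adj H v m ≟ᵇ β) ⟧

  ∈-level : ∀ {v β m} → m ∈ level v β ⇔ adj H v m ≡ β
  ∈-level {v} {β} = ∈⟦⟧ (λ m → adj H v m ≟ᵇ β)

  cut-∁ : ∀ {β U X} → Cut β U X → Cut β U (∁ X)
  cut-∁ record { inner = x , x∈U , x∈X ; outer = y , y∈U , y∉X ; cross = cross } = record
    { inner = y , y∈U , x∉p⇒x∈∁p y∉X
    ; outer = x , x∈U , x∈p⇒x∉∁p x∈X
    ; cross = λ a∈U a∈∁X b∈U b∉∁X → swapped (cross b∈U (x∉∁p⇒x∈p b∉∁X) a∈U (x∈∁p⇒x∉p a∈∁X))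
    }

  cut⇒split : ∀ {β U X} → Cut β U X → HomogeneousSplit H β U
  cut⇒split {β} {U} {X} record { inner = x , x∈U , x∈X ; outer = y , y∈U , y∉X ; cross = cross } =
    U ∩ X , U ∩ ∁ X ,
    (covers , disjoint , (x , x∈p∩q⁺ (x∈U , x∈X)) , (y , x∈p∩q⁺ (y∈U , x∉p⇒x∈∁p y∉X))) ,
    homogeneous
    where
    open ≡-Reasoning
    covers : (U ∩ X) ∪ (U ∩ ∁ X) ≡ U
    covers = begin
      (U ∩ X) ∪ (U ∩ ∁ X) ≡⟨ ∩-distribˡ-∪ U X (∁ X) ⟨
      U ∩ (X ∪ ∁ X)       ≡⟨ cong (U ∩_) (p∪∁p≡⊤ X) ⟩
      U ∩ ⊤               ≡⟨ ∩-identityʳ U ⟩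
      U                   ∎
    disjoint : (U ∩ X) ∩ (U ∩ ∁ X) ≡ ⊥
    disjoint = ⊆-antisym on-both-sides ⊥⊆
      where
      on-both-sides : ∀ {z} → z ∈ (U ∩ X) ∩ (U ∩ ∁ X) → z ∈ ⊥
      on-both-sides z∈ with x∈p∩q⁻ (U ∩ X) (U ∩ ∁ X) z∈
      ... | z∈U∩X , z∈U∩∁X = contradiction (proj₂ (x∈p∩q⁻ U X z∈U∩X))
                                           (x∈∁p⇒x∉p (proj₂ (x∈p∩q⁻ U (∁ X) z∈U∩∁X)))
    homogeneous : Homogeneous H β (U ∩ X) (U ∩ ∁ X)
    homogeneous a b a∈ b∈ with x∈p∩q⁻ U X a∈ | x∈p∩q⁻ U (∁ X) b∈
    ... | a∈U , a∈X | b∈U , b∈∁X = cross a∈U a∈X b∈U (x∈∁p⇒x∉p b∈∁X)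

  star-cut : ∀ {γ U v y} → v ∈ U → y ∈ U - v → (∀ {z} → z ∈ U - v → adj H v z ≡ γ) →
    Cut γ U ⁅ v ⁆
  star-cut {γ} {U} {v} {y} v∈U y∈U-v uniform = record
    { inner = v , v∈U , x∈⁅x⁆ v
    ; outer = y , proj₁ (∈-remove⁻ y∈U-v) , x≢y⇒x∉⁅y⁆ (proj₂ (∈-remove⁻ y∈U-v))
    ; cross = crossing
    }
    where
    crossing : ∀ {a b} → a ∈ U → a ∈ ⁅ v ⁆ → b ∈ U → b ∉ ⁅ v ⁆ → adj H a b ≡ γ
    crossing _ a∈⁅v⁆ b∈U b∉⁅v⁆ rewrite x∈⁅y⁆⇒x≡y v a∈⁅v⁆ =
      uniform (x∈p∧x≢y⇒x∈p-y b∈U (x∉⁅y⁆⇒x≢y b∉⁅v⁆))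

  absorb : ∀ {β U Y v} → v ∈ U → Cut β (U - v) Y →
    (∀ {x} → x ∈ (U - v) ∩ Y → adj H v x ≡ β) → Cut β U (Y - v)
  absorb {β} {U} {Y} {v} v∈U record { inner = x , x∈U-v , x∈Y ; cross = cross } toY = record
    { inner = x , proj₁ (∈-remove⁻ x∈U-v) , x∈p∧x≢y⇒x∈p-y x∈Y (proj₂ (∈-remove⁻ x∈U-v))
    ; outer = v , v∈U , λ v∈Y-v → proj₂ (∈-remove⁻ v∈Y-v) refl
    ; cross = crossing
    }
    where
    crossing : ∀ {a b} → a ∈ U → a ∈ Y - v → b ∈ U → b ∉ Y - v → adj H a b ≡ β
    crossing {a} {b} a∈U a∈Y-v b∈U b∉Y-v with ∈-remove⁻ a∈Y-v | b ≟ᶠ v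
    ... | a∈Y , a≢v | yes refl = swapped (toY (x∈p∩q⁺ (x∈p∧x≢y⇒x∈p-y a∈U a≢v , a∈Y)))
    ... | a∈Y , a≢v | no b≢v =
      cross (x∈p∧x≢y⇒x∈p-y a∈U a≢v) a∈Y (x∈p∧x≢y⇒x∈p-y b∈U b≢v)
            (λ b∈Y → b∉Y-v (x∈p∧x≢y⇒x∈p-y b∈Y b≢v))

  induced-path : ∀ {p q r s} → adj H p q ≡ true → adj H q r ≡ true → adj H r s ≡ true →
    adj H p r ≡ false → adj H p s ≡ false → adj H q s ≡ false → HasInducedP4 H
  induced-path {p} {q} {r} {s} pq qr rs pr ps qs = f , injective , shape
    where
    f : Fin 4 → Fin n
    f = lookup (p ∷ q ∷ r ∷ s ∷ [])
    shape : ∀ i j → adj H (f i) (f j) ≡ p4adj i j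
    shape p₀ p₀ = irrefl H p
    shape p₁ p₁ = irrefl H q
    shape p₂ p₂ = irrefl H r
    shape p₃ p₃ = irrefl H s
    shape p₀ p₁ = pq
    shape p₀ p₂ = pr
    shape p₀ p₃ = ps
    shape p₁ p₂ = qr
    shape p₁ p₃ = qs
    shape p₂ p₃ = rs
    shape p₁ p₀ = swapped pq
    shape p₂ p₀ = swapped pr
    shape p₃ p₀ = swapped ps
    shape p₂ p₁ = swapped qr
    shape p₃ p₁ = swapped qs
    shape p₃ p₂ = swapped rs
    injective : Injective _≡_ _≡_ f
    injective {i} {j} fi≡fj = p4-rows-distinct i j λ k →
      trans (≡.sym (shape i k)) (trans (cong (λ t → adj H t (f k)) fi≡fj) (shape j k))

  -- For β = false
  -- this is the path m - u - v - w, for β = true the path v - m - w - u.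
  obstruction : ∀ β {v m u w} → adj H v m ≡ β → adj H v u ≡ not β → adj H v w ≡ not β →
    adj H m u ≡ not β → adj H m w ≡ β → adj H u w ≡ β → HasInducedP4 H
  obstruction false vm vu vw mu mw uw = induced-path mu (swapped vu) vw (swapped vm) mw uw
  obstruction true vm vu vw mu mw uw = induced-path vm mw (swapped uw) vw vu mu

  -- In a cograph the β-neighbours of v on the
  -- X-side then cut U: any other vertex of the X-side is β-adjacent to them,
  -- since otherwise they form the obstruction with v and w.
  refine : ∀ {β U X v z w} → Cograph H → v ∈ U → Cut β (U - v) X →
    z ∈ U - v → z ∈ X → adj H v z ≡ β →
    w ∈ U - v → w ∉ X → adj H v w ≡ not β →
    Cut β U ((U - v) ∩ X ∩ level v β)
  refine {β} {U} {X} {v} {z} {w} cog v∈U c z∈U-v z∈X vz w∈U-v w∉X vw = record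
    { inner = z , proj₁ (∈-remove⁻ z∈U-v) , M⁺ z∈U-v z∈X vz
    ; outer = v , v∈U , λ v∈M → proj₂ (∈-remove⁻ (proj₁ (M⁻ v∈M))) refl
    ; cross = crossing
    }
    where
    open Cut c using (cross)
    M : Subset n
    M = (U - v) ∩ X ∩ level v β
    M⁺ : ∀ {m} → m ∈ U - v → m ∈ X → adj H v m ≡ β → m ∈ M
    M⁺ m∈U-v m∈X vm = x∈p∩q⁺ (m∈U-v , x∈p∩q⁺ (m∈X , Equivalence.from ∈-level vm))
    M⁻ : ∀ {m} → m ∈ M → m ∈ U - v × m ∈ X × adj H v m ≡ β
    M⁻ m∈M with x∈p∩q⁻ (U - v) _ m∈M
    ... | m∈U-v , m∈X∩level with x∈p∩q⁻ X (level v β) m∈X∩level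
    ...   | m∈X , m∈level = m∈U-v , m∈X , Equivalence.to ∈-level m∈level
    within-X : ∀ {a b} → a ∈ M → b ∈ U - v → b ∈ X → b ∉ M → adj H a b ≡ β
    within-X {a} {b} a∈M b∈U-v b∈X b∉M with M⁻ a∈M
    ... | a∈U-v , a∈X , va = decidable-stable (adj H a b ≟ᵇ β) λ ab≢β →
      cog (obstruction β va vb vw (¬-not ab≢β) (cross a∈U-v a∈X w∈U-v w∉X)
                                               (cross b∈U-v b∈X w∈U-v w∉X))
      where
      vb : adj H v b ≡ not β
      vb = ¬-not λ vb≡β → b∉M (M⁺ b∈U-v b∈X vb≡β)
    crossing : ∀ {a b} → a ∈ U → a ∈ M → b ∈ U → b ∉ M → adj H a b ≡ β
    crossing {a} {b} _ a∈M b∈U b∉M with b ≟ᶠ v | b ∈? X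
    ... | yes refl | _ = swapped (proj₂ (proj₂ (M⁻ a∈M)))
    ... | no b≢v | no b∉X =
      cross (proj₁ (M⁻ a∈M)) (proj₁ (proj₂ (M⁻ a∈M))) (x∈p∧x≢y⇒x∈p-y b∈U b≢v) b∉X
    ... | no b≢v | yes b∈X = within-X a∈M (x∈p∧x≢y⇒x∈p-y b∈U b≢v) b∈X b∉M

  extend-from : ∀ {β U X v z} → Cograph H → v ∈ U → Cut β (U - v) X →
    z ∈ U - v → z ∈ X → adj H v z ≡ β → Cuttable U
  extend-from {β} {U} {X} {v} cog v∈U c z∈U-v z∈X vz
    with all-or-counterexample (λ w → adj H v w ≟ᵇ β) ((U - v) ∩ ∁ X)
  ... | inj₁ all-β = β , ∁ X - v , absorb v∈U (cut-∁ c) all-β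
  ... | inj₂ (w , w∈ , vw≢β) with x∈p∩q⁻ (U - v) (∁ X) w∈
  ...   | w∈U-v , w∈∁X =
          β , _ , refine cog v∈U c z∈U-v z∈X vz w∈U-v (x∈∁p⇒x∉p w∈∁X) (¬-not vw≢β)

  extend : ∀ {β U X v} → Cograph H → v ∈ U → Cut β (U - v) X → Cuttable U
  extend {β} {U} {X} {v} cog v∈U c
    with all-or-counterexample (λ z → adj H v z ≟ᵇ not β) (U - v)
  ... | inj₁ all-not-β = not β , ⁅ v ⁆ , star-cut v∈U (proj₁ (proj₂ (Cut.inner c))) all-not-β
  ... | inj₂ (z , z∈U-v , vz≢¬β) with z ∈? X
  ...   | yes z∈X = extend-from cog v∈U c z∈U-v z∈X (≢not⇒≡ vz≢¬β)
  ...   | no z∉X = extend-from cog v∈U (cut-∁ c) z∈U-v (x∉p⇒x∈∁p z∉X) (≢not⇒≡ vz≢¬β)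

  cuttable : Cograph H → ∀ {U v y} → Acc _⊂_ U → v ∈ U → y ∈ U - v → Cuttable U
  cuttable cog {U} {v} {y} (acc smaller) v∈U y∈U-v with all-or-counterexample (_≟ᶠ y) (U - v)
  ... | inj₁ only-y = adj H v y , ⁅ v ⁆ , star-cut v∈U y∈U-v λ z∈U-v → cong (adj H v) (only-y z∈U-v)
  ... | inj₂ (z , z∈U-v , z≢y)
      with cuttable cog (smaller (x∈p⇒p-x⊂p v∈U)) y∈U-v (x∈p∧x≢y⇒x∈p-y z∈U-v z≢y)
  ...   | _ , _ , c = extend cog v∈U c

-- The cograph characterisation

cograph⇒splits : (H : Graph n) → Cograph H → EverySplits H
cograph⇒splits H cog U 2≤∣U∣ with two-elements⁺ U 2≤∣U∣
... | v , y , v∈U , y∈U , v≢y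
    with Cuts.cuttable H cog (⊂-wellFounded U) v∈U (x∈p∧x≢y⇒x∈p-y y∈U (≢-sym v≢y))
...   | β , _ , c = β , Cuts.cut⇒split H c

stays-in : (H : Graph n) {β : Bool} {U A B : Subset n} {x y : Fin n} →
  IsPartition U A B → Homogeneous H β A B → y ∈ U → adj H x y ≡ not β → x ∈ A → y ∈ A
stays-in H {A = A} {B} (A∪B≡U , _) hom y∈U xy x∈A with x∈p∪q⁻ A B (subst (_ ∈_) (≡.sym A∪B≡U) y∈U)
... | inj₁ y∈A = y∈A
... | inj₂ y∈B = ⊥-elim (not-¬ (hom _ _ x∈A y∈B) xy)

-- If one vertex of an induced P4 lies in A, then by p4-spread all of them do,
-- leaving the part B empty.
p4-in-one-part : (H : Graph n) (f : Fin 4 → Fin n) → (∀ i j → adj H (f i) (f j) ≡ p4adj i j) →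
  ∀ β {A B} → IsPartition (image f) A B → Homogeneous H β A B → f p₀ ∉ A
p4-in-one-part H f shape β {A} {B} partition@(A∪B≡U , A∩B≡⊥ , _ , (b , b∈B)) hom f₀∈A
  with ∈-image⁻ f (subst (b ∈_) A∪B≡U (x∈p∪q⁺ (inj₂ b∈B)))
... | j , refl = ∉⊥ (subst (f j ∈_) A∩B≡⊥ (x∈p∩q⁺ (all-in-A j , b∈B)))
  where
  all-in-A : ∀ i → f i ∈ A
  all-in-A = p4-spread β (λ i → f i ∈ A)
    (λ i j e → stays-in H partition hom (∈-image f j) (trans (shape i j) e))
    f₀∈A

-- The vertex set of an induced P4 has no homogeneous split.
splits⇒cograph : (H : Graph n) → EverySplits H → Cograph H
splits⇒cograph H splits (f , f-injective , shape)
  with splits (image f) (two-elements⁻ (∈-image f p₀) (∈-image f p₁) λ e → 0≢1+n (f-injective e))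
... | β , A , B , partition@(A∪B≡U , _) , hom
    with x∈p∪q⁻ A B (subst (f p₀ ∈_) (≡.sym A∪B≡U) (∈-image f p₀))
...   | inj₁ f₀∈A = p4-in-one-part H f shape β partition hom f₀∈A
...   | inj₂ f₀∈B =
        p4-in-one-part H f shape β (swap-partition partition) (swap-homogeneous H hom) f₀∈B

cograph⇔splits : (H : Graph n) → Cograph H ⇔ EverySplits H
cograph⇔splits H = mk⇔ (cograph⇒splits H) (splits⇒cograph H)

-- Colours and switching

isBlack : Colour → Bool
isBlack black = true
isBlack white = false

differ : Colour → Colour → Bool
differ c d = isBlack c xor isBlack d

Rule : Bool → Colour → Colour → Set
Rule true  c d = c ≡ d
Rule false c d = c ≢ d

BlackSet : (Fin n → Colour) → Subset n → Set
BlackSet c S = ∀ x → mem x S ≡ isBlack (c x)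

colourOf : Subset n → Fin n → Colour
colourOf S x with mem x S
... | true = black
... | false = white

colourOf-blackSet : (S : Subset n) → BlackSet (colourOf S) S
colourOf-blackSet S x with mem x S
... | true = refl
... | false = refl

blackVertices : (Fin n → Colour) → Subset n
blackVertices c = ⟦ (λ x → isBlack (c x) ≟ᵇ true) ⟧

blackVertices-blackSet : (c : Fin n → Colour) → BlackSet c (blackVertices c)
blackVertices-blackSet c x =
  trans (does-⇔ (∈⟦⟧ (λ x → isBlack (c x) ≟ᵇ true)) (x ∈? blackVertices c) (isBlack (c x) ≟ᵇ true))
        (does-≟true (isBlack (c x)))
  where
  does-≟true : ∀ b → does (b ≟ᵇ true) ≡ b
  does-≟true true = refl
  does-≟true false = refl

switch-differ : (G : Graph n) {c : Fin n → Colour} {S : Subset n} → BlackSet c S →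
  ∀ x y → adj (seidelSwitch G S) x y ≡ differ (c x) (c y) xor adj G x y
switch-differ G {c} {S} S-black x y rewrite ≡.sym (S-black x) | ≡.sym (S-black y)
  with mem x S xor mem y S
... | true = refl
... | false = refl

rule-from : ∀ β c d {g} → g ≡ differ c d xor β → (g ≡ true ⇔ Rule β c d)
rule-from true  black black refl = mk⇔ (λ _ → refl) (λ _ → refl)
rule-from true  white white refl = mk⇔ (λ _ → refl) (λ _ → refl)
rule-from true  black white refl = mk⇔ (λ ()) (λ ())
rule-from true  white black refl = mk⇔ (λ ()) (λ ())
rule-from false black black refl = mk⇔ (λ ()) (λ ne → ⊥-elim (ne refl))
rule-from false white white refl = mk⇔ (λ ()) (λ ne → ⊥-elim (ne refl))
rule-from false black white refl = mk⇔ (λ _ ()) (λ _ → refl)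
rule-from false white black refl = mk⇔ (λ _ ()) (λ _ → refl)

rule-to : ∀ β c d {g} → (g ≡ true ⇔ Rule β c d) → differ c d xor g ≡ β
rule-to true  black black rule = Equivalence.from rule refl
rule-to true  white white rule = Equivalence.from rule refl
rule-to true  black white rule = cong not (¬-not λ g≡true → case Equivalence.to rule g≡true of λ ())
rule-to true  white black rule = cong not (¬-not λ g≡true → case Equivalence.to rule g≡true of λ ())
rule-to false black black rule = ¬-not λ g≡true → Equivalence.to rule g≡true refl
rule-to false white white rule = ¬-not λ g≡true → Equivalence.to rule g≡true refl
rule-to false black white rule = cong not (Equivalence.from rule λ ())
rule-to false white black rule = cong not (Equivalence.from rule λ ())

Switched : (Fin n → Colour) → Graph n → Graph n → Set
Switched c G H = ∀ x y → adj G x y ≡ differ (c x) (c y) xor adj H x y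

RuleSplit : Graph n → (Fin n → Colour) → Bool → Subset n → Subset n → Set
RuleSplit G c β A B = ∀ a b → a ∈ A → b ∈ B → (Adj G a b ⇔ Rule β (c a) (c b))

homogeneous⇒rule : {c : Fin n → Colour} {G H : Graph n} {β : Bool} {A B : Subset n} →
  Switched c G H → Homogeneous H β A B → RuleSplit G c β A B
homogeneous⇒rule {c = c} {β = β} switched hom a b a∈A b∈B =
  rule-from β (c a) (c b) (trans (switched a b) (cong (differ (c a) (c b) xor_) (hom a b a∈A b∈B)))

rule⇒homogeneous : {c : Fin n → Colour} {G H : Graph n} {β : Bool} {A B : Subset n} →
  Switched c G H → RuleSplit G c β A B → Homogeneous H β A B
rule⇒homogeneous {c = c} {G} {H} {β} switched rule a b a∈A b∈B = begin
  adj H a b                   ≡⟨ xor-cancel d (adj H a b) ⟨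
  d xor (d xor adj H a b)     ≡⟨ cong (d xor_) (switched a b) ⟨
  d xor adj G a b             ≡⟨ rule-to β (c a) (c b) (rule a b a∈A b∈B) ⟩
  β                           ∎
  where
  open ≡-Reasoning
  d : Bool
  d = differ (c a) (c b)

ColourSplits : Graph n → (Fin n → Colour) → Set
ColourSplits {n} G c = ∀ (U : Subset n) → ∣ U ∣ ≥ 2 →
  Σ (Subset n) λ A → Σ (Subset n) λ B →
    IsPartition U A B × (RuleSplit G c true A B ⊎ RuleSplit G c false A B)

-- A Cameron graph G = switch H S: colour S black; homogeneous splits of the
-- cograph H are rule splits of G.
cameron⇒colouring : (G : Graph n) → IsCameron G → Σ (Fin n → Colour) (ColourSplits G)
cameron⇒colouring G (H , S , cog , G≡switch) = colourOf S , λ U 2≤∣U∣ →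
  let (β , A , B , partition , hom) = Equivalence.to (cograph⇔splits H) cog U 2≤∣U∣
  in A , B , partition , by-rule β (homogeneous⇒rule {c = colourOf S} {G} {H} switched hom)
  where
  switched : Switched (colourOf S) G H
  switched x y = trans (G≡switch x y) (switch-differ H (colourOf-blackSet S) x y)
  by-rule : ∀ β {A B} → RuleSplit G (colourOf S) β A B →
    RuleSplit G (colourOf S) true A B ⊎ RuleSplit G (colourOf S) false A B
  by-rule true = inj₁
  by-rule false = inj₂

-- Given a colouring c, switch G by its black vertices: rule splits of G are
-- homogeneous splits of the switch, which is therefore a cograph.
colouring⇒cameron : (G : Graph n) → Σ (Fin n → Colour) (ColourSplits G) → IsCameron G
colouring⇒cameron {n} G (c , rule-splits) =
  H , S , Equivalence.from (cograph⇔splits H) homogeneous-splits ,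
  λ x y → trans (switched x y) (≡.sym (switch-differ H S-black x y))
  where
  S : Subset n
  S = blackVertices c
  S-black : BlackSet c S
  S-black = blackVertices-blackSet c
  H : Graph n
  H = seidelSwitch G S
  switched : Switched c G H
  switched x y = ≡.sym (trans (cong (differ (c x) (c y) xor_) (switch-differ G S-black x y))
                              (xor-cancel (differ (c x) (c y)) (adj G x y)))
  as-homogeneous : ∀ {A B} → RuleSplit G c true A B ⊎ RuleSplit G c false A B →
    Σ Bool λ β → Homogeneous H β A B
  as-homogeneous (inj₁ rule) = true , rule⇒homogeneous {c = c} {G} {H} switched rule
  as-homogeneous (inj₂ rule) = false , rule⇒homogeneous {c = c} {G} {H} switched rule
  homogeneous-splits : EverySplits H
  homogeneous-splits U 2≤∣U∣ =
    let (A , B , partition , rule) = rule-splits U 2≤∣U∣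
        (β , hom) = as-homogeneous rule
    in β , A , B , partition , hom

mainTheorem2 : ∀ {n : ℕ} (G : Graph n) →
    IsCameron G ⇔
    (Σ (Fin n → Colour) λ c →
      ∀ (U : Subset n) → ∣ U ∣ ≥ 2 →
        Σ (Subset n) λ A → Σ (Subset n) λ B →
          IsPartition U A B ×
          ((∀ a b → a ∈ A → b ∈ B → (Adj G a b ⇔ c a ≡ c b))
           ⊎ (∀ a b → a ∈ A → b ∈ B → (Adj G a b ⇔ c a ≢ c b))))
mainTheorem2 G = mk⇔ (cameron⇒colouring G) (colouring⇒cameron G)
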